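{- Let $n > 3$ be a prime, and let $r \in \{1,2\}$ with $n \equiv r \pmod 3$. Suppose $p = 2^n - 1$ is prime. Then for every positive integer $k$ with $k \equiv \frac{rn-1}{3} \pmod n$ there exist positive integers $A,B,C,D$ with $\gcd(A,B,C) = p^k$ satisfying $A + B = C$ and $ABC = D^n$. -}

module Defs where

-- With p = 2ⁿ − 1 take (A, B, C) = (pᵏ, pᵏ⁺¹, 2ⁿpᵏ). Then A + B = C because 1 + p = 2ⁿ, and
-- A divides B and C, so gcd(A, B, C) = pᵏ. The congruence on k says exactly that n divides
-- 3k + 1 (as 3(rn − 1)/3 + 1 = rn), say 3k + 1 = mn; then ABC = 2ⁿp³ᵏ⁺¹ = (2pᵐ)ⁿ.
module Submission where

open import Defs
open import Data.Nat using (ℕ; _+_; _*_; _∸_; _^_; _<_; _%_; _/_)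
open import Data.Nat.GCD using (gcd)
open import Data.Nat.Primality using (Prime)
open import Data.Integer using (+_; _-_)
open import Data.Integer.Divisibility using (_∣_)
open import Data.Product using (Σ; _×_)
open import Data.Sum using (_⊎_)
open import Relation.Binary.PropositionalEquality using (_≡_)

open import Data.Nat using (zero; suc; NonZero; >-nonZero⁻¹)
open import Data.Nat.Properties
  using (+-comm; *-comm; *-commutativeSemigroup; *-suc; ^-distribˡ-+-*; ^-*-assoc; m^n≢0; m^n>0; m*n≢0; m+[n∸m]≡n)
open import Data.Nat.DivMod using (m≡m%n+[m/n]*n; m*n/n≡m; %-distribˡ-*)
import Data.Nat.Divisibility as ℕ
open import Data.Nat.GCD using (gcd[m,n]∣m; gcd-greatest)
open import Data.Nat.Primality using (prime⇒nonZero)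
open import Data.Nat.Tactic.RingSolver using (solve-∀)
open import Algebra.Properties.CommutativeSemigroup *-commutativeSemigroup
  renaming (interchange to *-interchange)
import Data.Integer as ℤ
import Data.Integer.Properties as ℤ
import Data.Integer.Divisibility.Signed as ℤ
import Data.Integer.Tactic.RingSolver as ℤ-Solver
open import Data.Product using (_,_)
open import Data.Sum using (inj₁; inj₂)
open import Relation.Binary.PropositionalEquality using (refl; sym; trans; cong; subst; module ≡-Reasoning)

m%d≡1⇒d*[[m∸1]/d]+1≡m : ∀ m d .{{_ : NonZero d}} → m % d ≡ 1 → d * ((m ∸ 1) / d) + 1 ≡ m
m%d≡1⇒d*[[m∸1]/d]+1≡m m d m%d≡1 = begin
  d * ((m ∸ 1) / d) + 1 ≡⟨ cong (λ x → d * ((x ∸ 1) / d) + 1) m≡1+q*d ⟩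
  d * (q * d / d) + 1   ≡⟨ cong (λ x → d * x + 1) (m*n/n≡m q d) ⟩
  d * q + 1             ≡⟨ +-comm (d * q) 1 ⟩
  1 + d * q             ≡⟨ cong suc (*-comm d q) ⟩
  1 + q * d             ≡⟨ sym m≡1+q*d ⟩
  m                     ∎
  where
  open ≡-Reasoning
  q = m / d
  m≡1+q*d : m ≡ 1 + q * d
  m≡1+q*d = trans (m≡m%n+[m/n]*n m d) (cong (_+ q * d) m%d≡1)

r*n%3≡1 : ∀ {r} n → (r ≡ 1 ⊎ r ≡ 2) → n % 3 ≡ r → r * n % 3 ≡ 1
r*n%3≡1 {r} n r≡1∨2 n%3≡r = begin
  r * n % 3             ≡⟨ %-distribˡ-* r n 3 ⟩
  r % 3 * (n % 3) % 3   ≡⟨ cong (λ x → r % 3 * x % 3) n%3≡r ⟩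
  r % 3 * r % 3         ≡⟨ r²%3≡1 r≡1∨2 ⟩
  1                     ∎
  where
  open ≡-Reasoning
  r²%3≡1 : (r ≡ 1 ⊎ r ≡ 2) → r % 3 * r % 3 ≡ 1
  r²%3≡1 (inj₁ refl) = refl
  r²%3≡1 (inj₂ refl) = refl

∣m-n⇒∣c*n+e⇒∣c*m+e : ∀ {d m n} c e → + d ∣ + m - + n → d ℕ.∣ c * n + e → d ℕ.∣ c * m + e
∣m-n⇒∣c*n+e⇒∣c*m+e {d} {m} {n} c e d∣m-n d∣cn+e =
  ℤ.∣⇒∣ᵤ (subst (+ d ℤ.∣_) (sym split)
    (ℤ.∣m∣n⇒∣m+n (ℤ.∣n⇒∣m*n (+ c) (ℤ.∣ᵤ⇒∣ d∣m-n)) (ℤ.∣ᵤ⇒∣ d∣cn+e)))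
  where
  open ≡-Reasoning
  pos-*-+ : ∀ x y z → + (x * y + z) ≡ + x ℤ.* + y ℤ.+ + z
  pos-*-+ x y z = trans (ℤ.pos-+ (x * y) z) (cong (λ i → i ℤ.+ + z) (ℤ.pos-* x y))
  regroup : ∀ x y w z → x ℤ.* y ℤ.+ z ≡ x ℤ.* (y - w) ℤ.+ (x ℤ.* w ℤ.+ z)
  regroup = ℤ-Solver.solve-∀
  split : + (c * m + e) ≡ + c ℤ.* (+ m - + n) ℤ.+ + (c * n + e)
  split = begin
    + (c * m + e)                                  ≡⟨ pos-*-+ c m e ⟩
    + c ℤ.* + m ℤ.+ + e                            ≡⟨ regroup (+ c) (+ m) (+ n) (+ e) ⟩
    + c ℤ.* (+ m - + n) ℤ.+ (+ c ℤ.* + n ℤ.+ + e) ≡⟨ cong (λ i → + c ℤ.* (+ m - + n) ℤ.+ i) (sym (pos-*-+ c n e)) ⟩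
    + c ℤ.* (+ m - + n) ℤ.+ + (c * n + e)          ∎

gcd[m,m*n]≡m : ∀ m n → gcd m (m * n) ≡ m
gcd[m,m*n]≡m m n = ℕ.∣-antisym (gcd[m,n]∣m m (m * n)) (gcd-greatest ℕ.∣-refl (ℕ.m∣m*n n))

^-distribʳ-* : ∀ m n o → (m * n) ^ o ≡ m ^ o * n ^ o
^-distribʳ-* m n zero    = refl
^-distribʳ-* m n (suc o) = begin
  m * n * (m * n) ^ o       ≡⟨ cong (m * n *_) (^-distribʳ-* m n o) ⟩
  m * n * (m ^ o * n ^ o)   ≡⟨ *-interchange m n (m ^ o) (n ^ o) ⟩
  m * m ^ o * (n * n ^ o)   ∎
  where open ≡-Reasoning

ABC-Solution : ℕ → ℕ → Set
ABC-Solution n g =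
  Σ ℕ λ A → Σ ℕ λ B → Σ ℕ λ C → Σ ℕ λ D →
    0 < A × 0 < B × 0 < C × 0 < D ×
    gcd (gcd A B) C ≡ g ×
    A + B ≡ C × A * B * C ≡ D ^ n

ABC-solution : ∀ p s n k m .{{_ : NonZero p}} .{{_ : NonZero s}} →
  suc p ≡ s ^ n → 3 * k + 1 ≡ m * n → ABC-Solution n (p ^ k)
ABC-solution p s n k m 1+p≡sⁿ 3k+1≡mn =
  a , a * p , a * s ^ n , s * p ^ m ,
  m^n>0 p k , positive (a * p) , positive (a * s ^ n) , positive (s * p ^ m) ,
  gcd≡a , sum , product
  where
  open ≡-Reasoning
  a = p ^ k
  instance
    _ = m^n≢0 p k
    _ = m^n≢0 p m
    _ = m^n≢0 s n
    _ = m*n≢0 a p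
    _ = m*n≢0 a (s ^ n)
    _ = m*n≢0 s (p ^ m)
  positive : ∀ x .{{_ : NonZero x}} → 0 < x
  positive x = >-nonZero⁻¹ x
  gcd≡a : gcd (gcd a (a * p)) (a * s ^ n) ≡ a
  gcd≡a = trans (cong (λ g → gcd g (a * s ^ n)) (gcd[m,m*n]≡m a p)) (gcd[m,m*n]≡m a (s ^ n))
  sum : a + a * p ≡ a * s ^ n
  sum = trans (sym (*-suc a p)) (cong (a *_) 1+p≡sⁿ)
  rearrange : ∀ x y q → x * (x * q) * (x * y) ≡ y * (x * (x * (x * 1)) * (q * 1))
  rearrange = solve-∀
  product : a * (a * p) * (a * s ^ n) ≡ (s * p ^ m) ^ n
  product = begin
    a * (a * p) * (a * s ^ n)     ≡⟨ rearrange a (s ^ n) p ⟩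
    s ^ n * (a ^ 3 * p ^ 1)       ≡⟨ cong (λ x → s ^ n * (x * p ^ 1)) (^-*-assoc p k 3) ⟩
    s ^ n * (p ^ (k * 3) * p ^ 1) ≡⟨ cong (λ e → s ^ n * (p ^ e * p ^ 1)) (*-comm k 3) ⟩
    s ^ n * (p ^ (3 * k) * p ^ 1) ≡⟨ cong (s ^ n *_) (sym (^-distribˡ-+-* p (3 * k) 1)) ⟩
    s ^ n * p ^ (3 * k + 1)       ≡⟨ cong (λ e → s ^ n * p ^ e) 3k+1≡mn ⟩
    s ^ n * p ^ (m * n)           ≡⟨ cong (s ^ n *_) (sym (^-*-assoc p m n)) ⟩
    s ^ n * (p ^ m) ^ n           ≡⟨ sym (^-distribʳ-* s (p ^ m) n) ⟩
    (s * p ^ m) ^ n               ∎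

corollary1 : (n r : ℕ) → Prime n → 3 < n → (r ≡ 1 ⊎ r ≡ 2) → n % 3 ≡ r →
    Prime (2 ^ n ∸ 1) →
    (k : ℕ) → 0 < k → (+ n) ∣ (+ k - + ((r * n ∸ 1) / 3)) →
    Σ ℕ λ A → Σ ℕ λ B → Σ ℕ λ C → Σ ℕ λ D →
    0 < A × 0 < B × 0 < C × 0 < D ×
    gcd (gcd A B) C ≡ (2 ^ n ∸ 1) ^ k ×
    A + B ≡ C × A * B * C ≡ D ^ n
corollary1 n r _ _ r≡1∨2 n%3≡r p-prime k _ n∣k-q =
  let ℕ.divides m 3k+1≡mn = n∣3k+1 in ABC-solution p 2 n k m 1+p≡2ⁿ 3k+1≡mn
  where
  p = 2 ^ n ∸ 1
  instance _ = prime⇒nonZero p-prime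
  q = (r * n ∸ 1) / 3
  3q+1≡rn : 3 * q + 1 ≡ r * n
  3q+1≡rn = m%d≡1⇒d*[[m∸1]/d]+1≡m (r * n) 3 (r*n%3≡1 n r≡1∨2 n%3≡r)
  n∣3k+1 : n ℕ.∣ 3 * k + 1
  n∣3k+1 = ∣m-n⇒∣c*n+e⇒∣c*m+e {n} {k} {q} 3 1 n∣k-q (subst (n ℕ.∣_) (sym 3q+1≡rn) (ℕ.n∣m*n r))
  1+p≡2ⁿ : suc p ≡ 2 ^ n
  1+p≡2ⁿ = m+[n∸m]≡n (m^n>0 2 n)
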